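{- Let $n$ be a positive integer and $G$ a subgroup of $U(n)$, and suppose that $\lambda(G)$ divides $\#\operatorname{Orb}(G;\vec v)$ for every $\vec v \in S(n)$. Then $\lambda(G)$ divides $n$.
   Context: $U(n)$ is the group of $2\times 2$ matrices $\begin{bmatrix} a & b \\ 0 & 1\end{bmatrix}$ with $a \in (\mathbb{Z}/n\mathbb{Z})^\times$ and $b \in \mathbb{Z}/n\mathbb{Z}$, under matrix multiplication. $S(n)$ is the set of column vectors $\begin{bmatrix} j \\ 1\end{bmatrix}$ with $j \in \mathbb{Z}/n\mathbb{Z}$, on which $G$ acts by matrix-vector multiplication: $\begin{bmatrix} a & b \\ 0 & 1\end{bmatrix}\begin{bmatrix} j \\ 1\end{bmatrix} = \begin{bmatrix} aj+b \\ 1\end{bmatrix}$. $\operatorname{Orb}(G;\vec v)$ is the $G$-orbit of $\vec v$, $\#X$ denotes cardinality, and $\lambda(G)$ is the minimum of $\#\operatorname{Orb}(G;\vec v)$ over $\vec v \in S(n)$. -}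

module Defs where

open import Data.Nat using (ℕ; _+_; _*_; NonZero)
open import Data.Nat.DivMod using (_mod_)
open import Data.Nat.Coprimality using (Coprime)
open import Data.Fin using (Fin; toℕ; _≟_)
open import Data.Fin.Properties using (any?)
open import Data.Product using (_×_; _,_; ∃; ∃-syntax; proj₁; proj₂)
open import Data.Product.Relation.Binary.Pointwise.NonDependent using ()
open import Data.List using (List; length; filter)
open import Data.List using () renaming (map to lmap)
open import Data.Fin.Base using () renaming (_+_ to _+F_)
open import Data.List.Base using ()
open import Data.Vec.Functional using ()
open import Relation.Nullary using (Dec; yes; no; ¬_)
open import Relation.Nullary.Decidable using (_×-dec_)
open import Relation.Unary using (Pred; Decidable)
open import Relation.Binary.PropositionalEquality using (_≡_)
open import Data.List using (allFin)

-- An element of the affine matrix group over ℤ/nℤ: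
--   [ a  b ]
--   [ 0  1 ]   represented by the pair (a , b) of residues mod n.
Mat : ℕ → Set
Mat n = Fin n × Fin n

module _ (n : ℕ) .{{_ : NonZero n}} where

  IsUnitMat : Mat n → Set
  IsUnitMat (a , b) = Coprime (toℕ a) n

  idMat : Mat n
  idMat = (1 mod n , 0 mod n)

  -- matrix multiplication  [a b;0 1][c d;0 1] = [ac  ad+b; 0 1]
  mulMat : Mat n → Mat n → Mat n
  mulMat (a , b) (c , d) =
    ((toℕ a * toℕ c) mod n , (toℕ a * toℕ d + toℕ b) mod n)

  -- action on S(n):  [a b;0 1][j;1] = [aj+b;1]   (vectors identified with j)
  act : Mat n → Fin n → Fin n
  act (a , b) j = (toℕ a * toℕ j + toℕ b) mod n

  record IsSubgroupOfU (G : Pred (Mat n) _) : Set where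
    field
      ⊆U      : ∀ g → G g → IsUnitMat g
      has-id  : G idMat
      mul-cl  : ∀ g h → G g → G h → G (mulMat g h)
      inv-cl  : ∀ g → G g → ∃[ h ] (G h × mulMat g h ≡ idMat × mulMat h g ≡ idMat)

  InOrb : (G : Pred (Mat n) _) → Fin n → Fin n → Set
  InOrb G j k = ∃[ g ] (G g × act g j ≡ k)

  inOrb? : (G : Pred (Mat n) _) → Decidable G → (j : Fin n) → Decidable (InOrb G j)
  inOrb? G G? j k with any? (λ a → any? (λ b → G? (a , b) ×-dec (act (a , b) j ≟ k)))
  ... | yes (a , b , p) = yes ((a , b) , p)
  ... | no ¬p = no λ { ((a , b) , p) → ¬p (a , b , p) }

  orbSize : (G : Pred (Mat n) _) → Decidable G → Fin n → ℕ
  orbSize G G? j = length (filter (inOrb? G G? j) (allFin n))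

{-# OPTIONS --safe #-}

-- The G-orbits partition S(n), so n is the sum of the orbit sizes and any common divisor of
-- all orbit sizes divides n.

module Submission where

open import Defs
open import Data.Bool using (true; false)
open import Data.Nat using (ℕ; NonZero; _≤_; _<_; suc; _+_; _*_; _%_; s≤s)
open import Data.Nat.Properties using (+-suc; +-identityʳ; *-identityˡ)
open import Data.Nat.DivMod using (_mod_; m%n%n≡m%n; %-distribˡ-+; %-distribˡ-*; m<n⇒m%n≡m)
open import Data.Nat.Divisibility using (_∣_; _∣0; ∣m∣n⇒∣m+n)
open import Data.Nat.Induction using (<-wellFounded)
open import Data.Nat.Solver using (module +-*-Solver)
open +-*-Solver using (solve; _:=_; _:+_; _:*_)
open import Data.Fin using (toℕ)
open import Data.Fin.Properties using (toℕ-fromℕ<; toℕ-injective; toℕ<n)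
open import Data.List using (List; []; _∷_; length; filter; allFin)
open import Data.List.Properties using (length-filter; filter-none; filter-reject; length-tabulate)
open import Data.List.Relation.Unary.All as All using ()
open import Data.List.Relation.Unary.All.Properties using (all-filter)
open import Data.Product using (∃-syntax; _×_; _,_)
open import Function using (_∘_)
open import Induction.WellFounded using (Acc; acc)
open import Level using (0ℓ)
open import Relation.Binary using (Rel; IsEquivalence)
open import Relation.Nullary using (¬_; yes; no; does)
open import Relation.Unary using (Pred; Decidable; _⊆_)
open import Relation.Unary.Properties using (∁?)
open import Relation.Binary.PropositionalEquality
  using (_≡_; refl; sym; trans; cong; cong₂; subst; module ≡-Reasoning)

import Relation.Binary.Definitions as B

module _ {A : Set} {P : Pred A 0ℓ} (P? : Decidable P) where

  length-filter+length-filter-∁ : ∀ xs →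
    length (filter P? xs) + length (filter (∁? P?) xs) ≡ length xs
  length-filter+length-filter-∁ [] = refl
  length-filter+length-filter-∁ (x ∷ xs) with ih ← length-filter+length-filter-∁ xs | does (P? x)
  ... | true  = cong suc ih
  ... | false = trans (+-suc _ _) (cong suc ih)

  filter-filter-⊆ : {Q : Pred A 0ℓ} (Q? : Decidable Q) → Q ⊆ P →
    ∀ xs → filter Q? (filter P? xs) ≡ filter Q? xs
  filter-filter-⊆ Q? Q⊆P [] = refl
  filter-filter-⊆ Q? Q⊆P (x ∷ xs) with P? x
  ... | no ¬Px = trans (filter-filter-⊆ Q? Q⊆P xs) (sym (filter-reject Q? (¬Px ∘ Q⊆P)))
  ... | yes _ with does (Q? x)
  ...   | true  = cong (x ∷_) (filter-filter-⊆ Q? Q⊆P xs)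
  ...   | false = filter-filter-⊆ Q? Q⊆P xs

module EquivalenceClasses {A : Set} {R : Rel A 0ℓ}
  (isEquivalence : IsEquivalence R) (R? : B.Decidable R) where

  open IsEquivalence isEquivalence renaming (refl to R-refl; sym to R-sym; trans to R-trans)

  classSize : A → List A → ℕ
  classSize x = length ∘ filter (R? x)

  withoutClass : A → List A → List A
  withoutClass x = filter (∁? (R? x))

  classSize-withoutClass-related : ∀ {x y} xs → R x y → classSize y (withoutClass x xs) ≡ 0
  classSize-withoutClass-related {x} xs Rxy =
    cong length (filter-none (R? _)
      (All.map (λ ¬Rxz Ryz → ¬Rxz (R-trans Rxy Ryz)) (all-filter (∁? (R? x)) xs)))

  classSize-withoutClass-unrelated : ∀ {x y} xs → ¬ R x y →
    classSize y (withoutClass x xs) ≡ classSize y xs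
  classSize-withoutClass-unrelated {x} {y} xs ¬Rxy =
    cong length (filter-filter-⊆ (∁? (R? x)) (R? y) (λ Ryz Rxz → ¬Rxy (R-trans Rxz (R-sym Ryz))) xs)

  length-withoutClass-< : ∀ x xs → length (withoutClass x (x ∷ xs)) < length (x ∷ xs)
  length-withoutClass-< x xs
    rewrite filter-reject (∁? (R? x)) {x} {xs} (λ ¬Rxx → ¬Rxx R-refl) =
      s≤s (length-filter (∁? (R? x)) xs)

  ∣classSize⇒∣length : ∀ {d} xs → (∀ y → d ∣ classSize y xs) → d ∣ length xs
  ∣classSize⇒∣length {d} xs = go xs (<-wellFounded (length xs))
    where
    go : ∀ xs → Acc _<_ (length xs) → (∀ y → d ∣ classSize y xs) → d ∣ length xs
    go [] _ _ = d ∣0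
    go (x ∷ xs) (acc rec) d∣classSize =
      subst (d ∣_) (length-filter+length-filter-∁ (R? x) (x ∷ xs))
        (∣m∣n⇒∣m+n (d∣classSize x) (go (withoutClass x (x ∷ xs)) (rec (length-withoutClass-< x xs)) d∣rest))
      where
      d∣rest : ∀ y → d ∣ classSize y (withoutClass x (x ∷ xs))
      d∣rest y with R? x y
      ... | yes Rxy = subst (d ∣_) (sym (classSize-withoutClass-related (x ∷ xs) Rxy)) (d ∣0)
      ... | no ¬Rxy = subst (d ∣_) (sym (classSize-withoutClass-unrelated (x ∷ xs) ¬Rxy)) (d∣classSize y)

module _ {d : ℕ} .{{_ : NonZero d}} where

  *-+-%-cong : ∀ {m m′ n n′ o o′} → m % d ≡ m′ % d → n % d ≡ n′ % d → o % d ≡ o′ % d →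
    (m * n + o) % d ≡ (m′ * n′ + o′) % d
  *-+-%-cong {m} {m′} {n} {n′} {o} {o′} m≡m′ n≡n′ o≡o′ = begin
    (m * n + o) % d                         ≡⟨ reduce m n o ⟩
    ((m % d * (n % d)) % d + o % d) % d     ≡⟨ cong₂ (λ s t → (s % d + t) % d) (cong₂ _*_ m≡m′ n≡n′) o≡o′ ⟩
    ((m′ % d * (n′ % d)) % d + o′ % d) % d  ≡⟨ sym (reduce m′ n′ o′) ⟩
    (m′ * n′ + o′) % d                      ∎
    where
    open ≡-Reasoning
    reduce : ∀ m n o → (m * n + o) % d ≡ ((m % d * (n % d)) % d + o % d) % d
    reduce m n o = trans (%-distribˡ-+ (m * n) o d) (cong (λ t → (t + o % d) % d) (%-distribˡ-* m n d))

  toℕ-mod : ∀ m → toℕ (m mod d) ≡ m % d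
  toℕ-mod m = toℕ-fromℕ< _

module _ (n : ℕ) .{{_ : NonZero n}} where

  act-idMat : ∀ j → act n (idMat n) j ≡ j
  act-idMat j = toℕ-injective (begin
    toℕ ((toℕ (1 mod n) * toℕ j + toℕ (0 mod n)) mod n)  ≡⟨ toℕ-mod _ ⟩
    (toℕ (1 mod n) * toℕ j + toℕ (0 mod n)) % n          ≡⟨ cong₂ (λ s t → (s * toℕ j + t) % n) (toℕ-mod 1) (toℕ-mod 0) ⟩
    (1 % n * toℕ j + 0 % n) % n                          ≡⟨ *-+-%-cong (m%n%n≡m%n 1 n) refl (m%n%n≡m%n 0 n) ⟩
    (1 * toℕ j + 0) % n                                  ≡⟨ cong (_% n) (trans (+-identityʳ (1 * toℕ j)) (*-identityˡ (toℕ j))) ⟩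
    toℕ j % n                                            ≡⟨ m<n⇒m%n≡m (toℕ<n j) ⟩
    toℕ j                                                ∎)
    where open ≡-Reasoning

  act-mulMat : ∀ g h j → act n (mulMat n g h) j ≡ act n g (act n h j)
  act-mulMat (a , b) (c , e) j = toℕ-injective (begin
    toℕ ((toℕ (ac mod n) * toℕ j + toℕ (aeb mod n)) mod n)  ≡⟨ toℕ-mod _ ⟩
    (toℕ (ac mod n) * toℕ j + toℕ (aeb mod n)) % n          ≡⟨ cong₂ (λ s t → (s * toℕ j + t) % n) (toℕ-mod ac) (toℕ-mod aeb) ⟩
    (ac % n * toℕ j + aeb % n) % n                          ≡⟨ *-+-%-cong (m%n%n≡m%n ac n) refl (m%n%n≡m%n aeb n) ⟩
    (ac * toℕ j + aeb) % n                                  ≡⟨ cong (_% n) (regroup (toℕ a) (toℕ b) (toℕ c) (toℕ e) (toℕ j)) ⟩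
    (toℕ a * cje + toℕ b) % n                               ≡⟨ *-+-%-cong {m = toℕ a} {o = toℕ b} refl (sym (m%n%n≡m%n cje n)) refl ⟩
    (toℕ a * (cje % n) + toℕ b) % n                         ≡⟨ cong (λ t → (toℕ a * t + toℕ b) % n) (sym (toℕ-mod cje)) ⟩
    (toℕ a * toℕ (cje mod n) + toℕ b) % n                   ≡⟨ sym (toℕ-mod _) ⟩
    toℕ ((toℕ a * toℕ (cje mod n) + toℕ b) mod n)           ∎)
    where
    open ≡-Reasoning
    ac = toℕ a * toℕ c
    aeb = toℕ a * toℕ e + toℕ b
    cje = toℕ c * toℕ j + toℕ e
    regroup : ∀ a b c e j → a * c * j + (a * e + b) ≡ a * (c * j + e) + b
    regroup = solve 5 (λ a b c e j → a :* c :* j :+ (a :* e :+ b) := a :* (c :* j :+ e) :+ b) refl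

  InOrb-isEquivalence : {G : Pred (Mat n) 0ℓ} → IsSubgroupOfU n G → IsEquivalence (InOrb n G)
  InOrb-isEquivalence {G} G≤U = record
    { refl  = λ {j} → idMat n , has-id , act-idMat j
    ; sym   = λ { {j} (g , Gg , refl) → InOrb-back j g Gg }
    ; trans = λ { {j} (g , Gg , refl) (h , Gh , refl) → mulMat n h g , mul-cl h g Gh Gg , act-mulMat h g j }
    }
    where
    open IsSubgroupOfU G≤U
    InOrb-back : ∀ j g → G g → InOrb n G (act n g j) j
    InOrb-back j g Gg with inv-cl g Gg
    ... | h , Gh , _ , hg≡id = h , Gh , (begin
      act n h (act n g j)    ≡⟨ sym (act-mulMat h g j) ⟩
      act n (mulMat n h g) j ≡⟨ cong (λ f → act n f j) hg≡id ⟩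
      act n (idMat n) j      ≡⟨ act-idMat j ⟩
      j                      ∎)
      where open ≡-Reasoning

lemma2p4 : (n : ℕ) .{{_ : NonZero n}}
    → (G : Pred (Mat n) 0ℓ) (G? : Decidable G) → IsSubgroupOfU n G
    → (lam : ℕ)
    → (∃[ j ] orbSize n G G? j ≡ lam) × (∀ j → lam ≤ orbSize n G G? j)
    → (∀ j → lam ∣ orbSize n G G? j)
    → lam ∣ n
lemma2p4 n G G? G≤U lam _ lam∣orbSize =
  subst (lam ∣_) (length-tabulate {n = n} (λ j → j)) (∣classSize⇒∣length (allFin n) lam∣orbSize)
  where open EquivalenceClasses (InOrb-isEquivalence n G≤U) (inOrb? n G G?)
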